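{- Define arrays $Lcp_0,Lcp_1,\dots$ of length $(k+1)m$ as follows. $Lcp_0[i]=0$ for all $i$. For $p\ge1$, $Lcp_p$ is obtained from $Lcp_{p-1}$ by the rule: for each position $i$, let $[b,e]$ be the $(p-1)$-segment of $X^{p-1}$ containing $i$, and let $c$ be the $p$-th symbol of the suffix $X^p[i]$ (with $c=\$$ if that suffix has length smaller than $p$); if $c\neq\$$ and $i>b$ and the suffix $X^p[i-1]$ has the same $p$-th symbol $c$, then $Lcp_p[i]=p$; otherwise $Lcp_p[i]=Lcp_{p-1}[i]$. Then for every $p\ge1$ and every position $1\le i\le (k+1)m$, $Lcp_p[i]=p$ if and only if $i$ is not the start position of any $p$-segment of $X^p$.
   Context: Let $S=\{s_1,\dots,s_m\}$ be strings each of exactly $k$ symbols over a totally ordered alphabet $\Sigma'=\{c_1<\dots<c_\sigma\}$; $s_j[i]$ denotes the $i$-th symbol. Each $s_j$ is terminated by its own sentinel $\$_j$, with $\$_1<\$_2<\dots<\$_m<c_1$; the symbol $\$$ denotes a generic sentinel, smaller than all symbols of $\Sigma'$. A suffix of $S$ is a pair $\alpha=(l,j)$ with $0\le l\le k$, $1\le j\le m$, representing $s_j[k-l+1:k]$ (empty if $l=0$); its length is $l_\alpha=l$, its string index $i_\alpha=j$, and for $l\ge p$ its $p$-th symbol is $s_j[k-l+p]$. Its extended string is $\bar\alpha=s_j[k-l+1:k]\,\$_j$. For $p\ge 0$, the $p$-prefix $\alpha[:p]$ is the prefix of $\bar\alpha$ of length $\min(p,l+1)$. For $p\ge0$, $\alpha\prec_p\beta$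 iff (1) $\alpha[:p]$ is lexicographically strictly smaller than $\beta[:p]$, or (2) $\alpha[:p]=\beta[:p]$ and $l_\alpha<l_\beta$, or (3) $\alpha[:p]=\beta[:p]$, $l_\alpha=l_\beta$ and $i_\alpha<i_\beta$. The $p$-interleave $X^p$ is the array of length $(k+1)m$ whose $i$-th entry is the $i$-th smallest suffix in the $\prec_p$ order. A $p$-segment of $X^p$ is a maximal interval $[b,e]$ of positions such that all suffixes $X^p[b],\dots,X^p[e]$ have the same $p$-prefix; $b$ is its start position. The rule defining $Lcp_p$ is the update performed at iteration $p$ of the paper's merging procedure. -}

module Defs where

open import Data.Nat using (ℕ; zero; suc; _+_; _*_; _∸_; _≤_; _<_)
open import Data.Fin using (Fin; toℕ)
open import Data.Vec using (Vec; toList)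
open import Data.List using (List; []; _∷_; _++_; take; drop; map)
open import Data.Maybe using (Maybe; just; nothing)
open import Data.Product using (Σ; ∃; ∃-syntax; _×_; _,_; proj₁; proj₂)
open import Data.Sum using (_⊎_)
open import Relation.Nullary using (¬_)
open import Relation.Binary.PropositionalEquality using (_≡_)
open import Data.List.Relation.Binary.Lex.Strict using (Lex-<)

-- Alphabet Σ' = {c_1 < ... < c_σ} is Fin σ (ordered by toℕ).
-- The strings s_1..s_m are a family  s : Fin m → Vec (Fin σ) k
-- (string index j ∈ {1..m} is represented 0-based by Fin m; order preserved).

data Sym (σ m : ℕ) : Set where
  sent : Fin m → Sym σ m
  char : Fin σ → Sym σ m

data _<ˢ_ {σ m : ℕ} : Sym σ m → Sym σ m → Set where
  sent<sent : ∀ {j j'} → toℕ j < toℕ j' → sent j <ˢ sent j'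
  sent<char : ∀ {j c} → sent j <ˢ char c
  char<char : ∀ {c c'} → toℕ c < toℕ c' → char c <ˢ char c'

-- A suffix α = (l , j) with 0 ≤ l ≤ k.
Suffix : ℕ → ℕ → Set
Suffix k m = Fin (suc k) × Fin m

len : ∀ {k m} → Suffix k m → ℕ
len (l , j) = toℕ l

idx : ∀ {k m} → Suffix k m → ℕ
idx (l , j) = toℕ j

module _ {σ k m : ℕ} (s : Fin m → Vec (Fin σ) k) where

  ext : Suffix k m → List (Sym σ m)
  ext (l , j) = map char (drop (k ∸ toℕ l) (toList (s j))) ++ (sent j ∷ [])

  pre : ℕ → Suffix k m → List (Sym σ m)
  pre p α = take p (ext α)

  Prec : ℕ → Suffix k m → Suffix k m → Set
  Prec p α β =
    Lex-< _≡_ _<ˢ_ (pre p α) (pre p β)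
    ⊎ (pre p α ≡ pre p β × len α < len β)
    ⊎ (pre p α ≡ pre p β × len α ≡ len β × idx α < idx β)

  -- number of suffixes = length of the interleave arrays
  N : ℕ
  N = suc k * m

  -- Arrays of length N are functions on positions 1..N (values outside
  -- this range are irrelevant).
  -- X is the p-interleave: its i-th entry is the i-th smallest suffix in ≺_p.
  IsInterleave : ℕ → (ℕ → Suffix k m) → Set
  IsInterleave p X =
    (∀ i i' → 1 ≤ i → i < i' → i' ≤ N → Prec p (X i) (X i'))
    × (∀ α → ∃[ i ] (1 ≤ i × i ≤ N × X i ≡ α))

  SamePrefixOn : ℕ → (ℕ → Suffix k m) → ℕ → ℕ → Set
  SamePrefixOn p X b e =
    ∀ i i' → b ≤ i → i ≤ e → b ≤ i' → i' ≤ e → pre p (X i) ≡ pre p (X i')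

  IsSegment : ℕ → (ℕ → Suffix k m) → ℕ → ℕ → Set
  IsSegment p X b e =
    1 ≤ b × b ≤ e × e ≤ N × SamePrefixOn p X b e
    × (∀ b' e' → 1 ≤ b' → b' ≤ b → e ≤ e' → e' ≤ N → SamePrefixOn p X b' e'
         → b' ≡ b × e' ≡ e)

  IsSegmentStart : ℕ → (ℕ → Suffix k m) → ℕ → Set
  IsSegmentStart p X i = ∃[ e ] IsSegment p X i e

  -- p-th symbol of α (p ≥ 1): just s_j[k-l+p] if l ≥ p, nothing (= $) otherwise
  nth : ∀ {A : Set} → List A → ℕ → Maybe A
  nth [] n = nothing
  nth (x ∷ xs) zero = just x
  nth (x ∷ xs) (suc n) = nth xs n

  pthSym : ℕ → Suffix k m → Maybe (Fin σ)
  pthSym zero α = nothing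
  pthSym (suc q) α with nth (ext α) q
  ... | just (char c) = just c
  ... | _ = nothing

  -- The condition of the update rule at iteration p = suc q, position i
  -- (X is the family of interleaves X^0, X^1, ...):
  --   c ≠ $, i > b where [b,e] is the (p-1)-segment of X^{p-1} containing i,
  --   and X^p[i-1] has the same p-th symbol c.
  UpdateCond : (ℕ → ℕ → Suffix k m) → ℕ → ℕ → Set
  UpdateCond X q i =
    (∃[ c ] (pthSym (suc q) (X (suc q) i) ≡ just c
             × pthSym (suc q) (X (suc q) (i ∸ 1)) ≡ just c))
    × (∃[ b ] ∃[ e ] (IsSegment q (X q) b e × b ≤ i × i ≤ e × b < i))

  IsLcp : (ℕ → ℕ → Suffix k m) → (ℕ → ℕ → ℕ) → Set
  IsLcp X L =
    (∀ i → 1 ≤ i → i ≤ N → L 0 i ≡ 0)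
    × (∀ q i → 1 ≤ i → i ≤ N →
         (UpdateCond X q i → L (suc q) i ≡ suc q)
         × (¬ UpdateCond X q i → L (suc q) i ≡ L q i))

module Submission where

-- Two arrays that list the same finite set and are both sorted by a common key carry the same key
-- at every position.  Since ≺_{q+1} refines the order of q-prefixes, this applies to X^q and X^{q+1}
-- with the q-prefix as key: the q-segments of X^q and of X^{q+1} occupy the same intervals.  Hence
-- the update condition at position i says exactly that X^{q+1}[i-1] and X^{q+1}[i] share their
-- q-prefix and their (q+1)-th symbol, which is not a sentinel, i.e. that they share their
-- (q+1)-prefix; and in a sorted array this is the same as i not starting a (q+1)-segment.  Finally
-- Lcp_q ≤ q, so Lcp_{q+1}[i] = q+1 holds precisely when the update fired.

open import Defs
open import Data.Nat using (ℕ; zero; suc; _≤_; _<_; _∸_; z≤n; s≤s; _≤?_)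
open import Data.Nat.Properties
  using ( ≤-refl; ≤-trans; ≤-reflexive; ≤-antisym; ≤-pred; <⇒≤; <⇒≢; <⇒≱; ≰⇒>; ≮⇒≥; ≤∧≢⇒<
        ; <-irrefl; <-trans; <-cmp; n≤1+n; n<1+n; 1+n≰n; m≤n⇒m≤1+n; m≤n⇒m<n∨m≡n; m≤n⇒m⊓n≡m
        ; m∸[m∸n]≡n; ∸-monoˡ-<; ∸-cancelʳ-≡; suc-injective; module ≤-Reasoning )
open import Data.Fin using (Fin; toℕ; fromℕ<)
open import Data.Fin.Properties as Fin using (toℕ-injective; toℕ<n; toℕ-fromℕ<; pigeonhole)
open import Data.Vec using (Vec; toList)
open import Data.Vec.Properties using (length-toList)
open import Data.List using (List; []; _∷_; _++_; take; drop; map; length)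
open import Data.List.Properties using (length-drop; take-take)
open import Data.List.Relation.Binary.Lex.Strict as Lex using (Lex-<; base; halt; this; next)
open import Data.List.Relation.Binary.Pointwise using (Pointwise-≡⇒≡; ≡⇒Pointwise-≡)
open import Data.Maybe using (just; nothing)
open import Data.Product using (∃-syntax; _×_; _,_; proj₁; proj₂)
open import Data.Sum using (_⊎_; inj₁; inj₂)
open import Data.Empty using (⊥-elim)
open import Level using (_⊔_)
open import Function using (_∘_; _⇔_; mk⇔; Equivalence)
open import Relation.Nullary using (¬_; yes; no)
open import Relation.Nullary.Decidable using (_×-dec_; decidable-stable)
open import Relation.Unary as U using (Pred)
open import Relation.Binary
  using (Rel; DecidableEquality; IsStrictTotalOrder; Trichotomous; Transitive; Irreflexive; Trans; tri<; tri≈; tri>)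
open import Relation.Binary.Consequences using (tri⇒irr)
import Relation.Binary.Construct.StrictToNonStrict as StrictToNonStrict
open import Relation.Binary.PropositionalEquality
  using (_≡_; _≢_; refl; sym; trans; cong; subst; subst₂; resp₂; isEquivalence; module ≡-Reasoning)

module _ {σ m : ℕ} where

  <ˢ-compare : Trichotomous _≡_ (_<ˢ_ {σ} {m})
  <ˢ-compare (sent i) (sent j) with Fin.<-cmp i j
  ... | tri< i<j i≢j i≯j = tri< (sent<sent i<j) (λ { refl → i≢j refl }) (λ { (sent<sent j<i) → i≯j j<i })
  ... | tri≈ i≮i refl _  = tri≈ (λ { (sent<sent i<i) → i≮i i<i }) refl (λ { (sent<sent i<i) → i≮i i<i })
  ... | tri> i≮j i≢j j<i = tri> (λ { (sent<sent i<j) → i≮j i<j }) (λ { refl → i≢j refl }) (sent<sent j<i)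
  <ˢ-compare (sent _) (char _) = tri< sent<char (λ ()) (λ ())
  <ˢ-compare (char _) (sent _) = tri> (λ ()) (λ ()) sent<char
  <ˢ-compare (char c) (char d) with Fin.<-cmp c d
  ... | tri< c<d c≢d c≯d = tri< (char<char c<d) (λ { refl → c≢d refl }) (λ { (char<char d<c) → c≯d d<c })
  ... | tri≈ c≮c refl _  = tri≈ (λ { (char<char c<c) → c≮c c<c }) refl (λ { (char<char c<c) → c≮c c<c })
  ... | tri> c≮d c≢d d<c = tri> (λ { (char<char c<d) → c≮d c<d }) (λ { refl → c≢d refl }) (char<char d<c)

  <ˢ-trans : Transitive (_<ˢ_ {σ} {m})
  <ˢ-trans (sent<sent i<j) (sent<sent j<k) = sent<sent (<-trans i<j j<k)
  <ˢ-trans (sent<sent _)   sent<char       = sent<char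
  <ˢ-trans sent<char       (char<char _)   = sent<char
  <ˢ-trans (char<char c<d) (char<char d<e) = char<char (<-trans c<d d<e)

  <ˢ-isStrictTotalOrder : IsStrictTotalOrder _≡_ (_<ˢ_ {σ} {m})
  <ˢ-isStrictTotalOrder = record
    { isStrictPartialOrder = record
      { isEquivalence = isEquivalence
      ; irrefl        = tri⇒irr <ˢ-compare
      ; trans         = <ˢ-trans
      ; <-resp-≈      = resp₂ _<ˢ_
      }
    ; compare = <ˢ-compare
    }

  _<ᴸ_ : Rel (List (Sym σ m)) _
  _<ᴸ_ = Lex-< _≡_ _<ˢ_

  _≼ᴸ_ : Rel (List (Sym σ m)) _
  _≼ᴸ_ = StrictToNonStrict._≤_ _≡_ _<ᴸ_

  <ᴸ-isStrictTotalOrder : IsStrictTotalOrder _≡_ _<ᴸ_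
  <ᴸ-isStrictTotalOrder = record
    { isStrictPartialOrder = record
      { isEquivalence = isEquivalence
      ; irrefl        = λ { refl → PointwiseLex.irrefl (≡⇒Pointwise-≡ refl) }
      ; trans         = PointwiseLex.trans
      ; <-resp-≈      = resp₂ _<ᴸ_
      }
    ; compare = compare
    }
    where
      module PointwiseLex = IsStrictTotalOrder (Lex.<-isStrictTotalOrder <ˢ-isStrictTotalOrder)

      compare : Trichotomous _≡_ _<ᴸ_
      compare xs ys with PointwiseLex.compare xs ys
      ... | tri< xs<ys xs≉ys xs≯ys = tri< xs<ys (xs≉ys ∘ ≡⇒Pointwise-≡) xs≯ys
      ... | tri≈ xs≮ys xs≈ys xs≯ys = tri≈ xs≮ys (Pointwise-≡⇒≡ xs≈ys) xs≯ys
      ... | tri> xs≮ys xs≉ys xs>ys = tri> xs≮ys (xs≉ys ∘ ≡⇒Pointwise-≡) xs>ys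

  _≟ᴸ_ : DecidableEquality (List (Sym σ m))
  _≟ᴸ_ = IsStrictTotalOrder._≟_ <ᴸ-isStrictTotalOrder

module _ {a ℓ} {A : Set a} {_≺_ : Rel A ℓ} where

  take-mono-Lex-< : ∀ q {xs ys : List A} → Lex-< _≡_ _≺_ xs ys →
                    Lex-< _≡_ _≺_ (take q xs) (take q ys) ⊎ take q xs ≡ take q ys
  take-mono-Lex-< zero    _                = inj₂ refl
  take-mono-Lex-< (suc q) (base ())
  take-mono-Lex-< (suc q) halt             = inj₁ halt
  take-mono-Lex-< (suc q) (this x≺y)       = inj₁ (this x≺y)
  take-mono-Lex-< (suc q) (next refl xs<ys) with take-mono-Lex-< q xs<ys
  ... | inj₁ lt = inj₁ (next refl lt)
  ... | inj₂ eq = inj₂ (cong (_ ∷_) eq)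

least : ∀ {p} {P : Pred ℕ p} → U.Decidable P → ∀ {n} → P n →
        ∃[ b ] (b ≤ n × P b × (∀ {b'} → b' < b → ¬ P b'))
least P? {zero}  Pn = 0 , z≤n , Pn , λ ()
least P? {suc n} Pn with P? 0
... | yes P0 = 0 , z≤n , P0 , λ ()
... | no ¬P0 with least (P? ∘ suc) Pn
...   | b , b≤n , Pb , below = suc b , s≤s b≤n , Pb , λ { {zero} _ → ¬P0 ; {suc _} b'<b → below (≤-pred b'<b) }

greatest : ∀ {p} {P : Pred ℕ p} → U.Decidable P → ∀ {i M} → i ≤ M → P i →
           ∃[ e ] (i ≤ e × e ≤ M × P e × (∀ {e'} → e < e' → e' ≤ M → ¬ P e'))
greatest P? {M = zero} z≤n Pi = 0 , z≤n , z≤n , Pi , λ e<e' e'≤0 → ⊥-elim (<⇒≱ e<e' e'≤0)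
greatest {P = P} P? {M = suc M} i≤1+M Pi with P? (suc M)
... | yes P1+M = suc M , i≤1+M , ≤-refl , P1+M , λ e<e' e'≤1+M → ⊥-elim (<⇒≱ e<e' e'≤1+M)
... | no ¬P1+M with m≤n⇒m<n∨m≡n i≤1+M
...   | inj₂ refl = ⊥-elim (¬P1+M Pi)
...   | inj₁ i<1+M with greatest P? (≤-pred i<1+M) Pi
...     | e , i≤e , e≤M , Pe , above = e , i≤e , m≤n⇒m≤1+n e≤M , Pe , above′
  where
    above′ : ∀ {e'} → e < e' → e' ≤ suc M → ¬ P e'
    above′ e<e' e'≤1+M with m≤n⇒m<n∨m≡n e'≤1+M
    ... | inj₁ e'<1+M = above e<e' (≤-pred e'<1+M)
    ... | inj₂ refl   = ¬P1+M

module Positions (n : ℕ) {a} {A : Set a} where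

  IncreasingOn : ∀ {r} → Rel A r → (ℕ → A) → Set r
  IncreasingOn R Y = ∀ i i' → 1 ≤ i → i < i' → i' ≤ n → R (Y i) (Y i')

  InjectiveOn : (ℕ → A) → Set a
  InjectiveOn Y = ∀ {j j'} → 1 ≤ j → j ≤ n → 1 ≤ j' → j' ≤ n → Y j ≡ Y j' → j ≡ j'

  SurjectiveOn : (ℕ → A) → Set a
  SurjectiveOn Y = ∀ α → ∃[ j ] (1 ≤ j × j ≤ n × Y j ≡ α)

  IsEnumeration : (ℕ → A) → Set a
  IsEnumeration Y = InjectiveOn Y × SurjectiveOn Y

  increasing⇒injective : ∀ {r} {R : Rel A r} {Y} → Irreflexive _≡_ R → IncreasingOn R Y → InjectiveOn Y
  increasing⇒injective irr increasing {j} {j'} 1≤j j≤n 1≤j' j'≤n Yj≡Yj' with <-cmp j j'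
  ... | tri< j<j' _ _ = ⊥-elim (irr Yj≡Yj' (increasing j j' 1≤j j<j' j'≤n))
  ... | tri≈ _ j≡j' _ = j≡j'
  ... | tri> _ _ j'<j = ⊥-elim (irr (sym Yj≡Yj') (increasing j' j 1≤j' j'<j j≤n))

module SortedArrays {ℓ₁ ℓ₂} {K : Set ℓ₁} {_≺_ : Rel K ℓ₂}
                    (sto : IsStrictTotalOrder _≡_ _≺_) (n : ℕ) where

  open StrictToNonStrict _≡_ _≺_ using () renaming (_≤_ to _≼_)

  private
    module O = IsStrictTotalOrder sto

    ≼-trans : Transitive _≼_
    ≼-trans = StrictToNonStrict.trans _≡_ _≺_ O.isEquivalence O.<-resp-≈ O.trans

    ≼-≺-trans : Trans _≼_ _≺_ _≺_
    ≼-≺-trans = StrictToNonStrict.≤-<-trans _≡_ _≺_ sym O.trans O.<-respˡ-≈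

  Sorted : (ℕ → K) → Set (ℓ₁ ⊔ ℓ₂)
  Sorted key = ∀ {j j'} → 1 ≤ j → j ≤ j' → j' ≤ n → key j ≼ key j'

  sorted-convex : ∀ key {a j c} → Sorted key → 1 ≤ a → a ≤ j → j ≤ c → c ≤ n →
                  key a ≡ key c → key j ≡ key a
  sorted-convex _ sorted 1≤a a≤j j≤c c≤n ka≡kc
    with sorted 1≤a a≤j (≤-trans j≤c c≤n) | sorted (≤-trans 1≤a a≤j) j≤c c≤n
  ... | inj₂ ka≡kj | _           = sym ka≡kj
  ... | inj₁ _     | inj₂ kj≡kc  = trans kj≡kc (sym ka≡kc)
  ... | inj₁ ka<kj | inj₁ kj<kc  = ⊥-elim (O.irrefl ka≡kc (O.trans ka<kj kj<kc))

  module _ {b} {A : Set b} where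
    open Positions n {A = A}

    increasing⇒sorted : ∀ {r} {R : Rel A r} {Y} (key : A → K) → (∀ {x y} → R x y → key x ≼ key y) →
                        IncreasingOn R Y → Sorted (key ∘ Y)
    increasing⇒sorted key mono increasing 1≤j j≤j' j'≤n with m≤n⇒m<n∨m≡n j≤j'
    ... | inj₁ j<j' = mono (increasing _ _ 1≤j j<j' j'≤n)
    ... | inj₂ refl = inj₂ refl

    -- If key (Y i) ≺ key (Z i), each of Y 1, …, Y i sits in Z at a position below i,
    -- and pigeonhole contradicts the injectivity of Y.
    sorted-key≮ : (key : A → K) {Y Z : ℕ → A} → Sorted (key ∘ Y) → Sorted (key ∘ Z) →
                  InjectiveOn Y → SurjectiveOn Z → ∀ {i} → 1 ≤ i → i ≤ n → ¬ key (Y i) ≺ key (Z i)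
    sorted-key≮ key {Y} {Z} sortedY sortedZ injectiveY surjectiveZ {suc i'} _ i≤n kYi<kZi =
      let t , t' , t<t' , slot≡ = pigeonhole (n<1+n i') slot in <-irrefl (slot-injective slot≡) t<t'
      where
        entry≤i : ∀ (t : Fin (suc i')) → suc (toℕ t) ≤ suc i'
        entry≤i = toℕ<n

        position : Fin (suc i') → ℕ
        position t = proj₁ (surjectiveZ (Y (suc (toℕ t))))

        1≤position : ∀ t → 1 ≤ position t
        1≤position t = proj₁ (proj₂ (surjectiveZ (Y (suc (toℕ t)))))

        position≤n : ∀ t → position t ≤ n
        position≤n t = proj₁ (proj₂ (proj₂ (surjectiveZ (Y (suc (toℕ t))))))

        Z-position : ∀ t → Z (position t) ≡ Y (suc (toℕ t))
        Z-position t = proj₂ (proj₂ (proj₂ (surjectiveZ (Y (suc (toℕ t))))))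

        position<i : ∀ t → position t < suc i'
        position<i t = ≰⇒> λ i≤pos → O.irrefl refl
          (≼-≺-trans (≼-trans (sortedZ (s≤s z≤n) i≤pos (position≤n t)) (inj₂ (cong key (Z-position t))))
                     (≼-≺-trans (sortedY (s≤s z≤n) (entry≤i t) i≤n) kYi<kZi))

        slot : Fin (suc i') → Fin i'
        slot t = fromℕ< (∸-monoˡ-< (position<i t) (1≤position t))

        slot-injective : ∀ {t t'} → slot t ≡ slot t' → toℕ t ≡ toℕ t'
        slot-injective {t} {t'} slot≡ = suc-injective (injectiveY (s≤s z≤n) (≤-trans (entry≤i t) i≤n)
                                                                  (s≤s z≤n) (≤-trans (entry≤i t') i≤n) Y≡)
          where
            position≡ : position t ≡ position t'
            position≡ = ∸-cancelʳ-≡ (1≤position t) (1≤position t')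
              (trans (sym (toℕ-fromℕ< _)) (trans (cong toℕ slot≡) (toℕ-fromℕ< _)))
            Y≡ : Y (suc (toℕ t)) ≡ Y (suc (toℕ t'))
            Y≡ = trans (sym (Z-position t)) (trans (cong Z position≡) (Z-position t'))

    sorted-keys-agree : (key : A → K) {Y Z : ℕ → A} → Sorted (key ∘ Y) → Sorted (key ∘ Z) →
                        IsEnumeration Y → IsEnumeration Z → ∀ {i} → 1 ≤ i → i ≤ n → key (Y i) ≡ key (Z i)
    sorted-keys-agree key {Y} {Z} sortedY sortedZ (injY , surY) (injZ , surZ) {i} 1≤i i≤n
      with O.compare (key (Y i)) (key (Z i))
    ... | tri< lt _ _ = ⊥-elim (sorted-key≮ key sortedY sortedZ injY surZ 1≤i i≤n lt)
    ... | tri≈ _ eq _ = eq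
    ... | tri> _ _ gt = ⊥-elim (sorted-key≮ key sortedZ sortedY injZ surY 1≤i i≤n gt)

module _ {σ k m : ℕ} (s : Fin m → Vec (Fin σ) k) where

  nth-take : ∀ {A : Set} {t n} (xs : List A) → t < n → nth s (take n xs) t ≡ nth s xs t
  nth-take {n = suc _}         []       _         = refl
  nth-take {t = zero}  {suc _} (x ∷ xs) _         = refl
  nth-take {t = suc _} {suc _} (x ∷ xs) (s≤s t<n) = nth-take xs t<n

  take-suc-nth : ∀ {A : Set} q (xs : List A) {x} → nth s xs q ≡ just x → take (suc q) xs ≡ take q xs ++ x ∷ []
  take-suc-nth q       []       ()
  take-suc-nth zero    (y ∷ ys) refl = refl
  take-suc-nth (suc q) (y ∷ ys) nth≡ = cong (y ∷_) (take-suc-nth q ys nth≡)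

  nth-letters : ∀ (ys : List (Fin σ)) {z : Sym σ m} {t} → t < length ys →
                ∃[ c ] nth s (map char ys ++ z ∷ []) t ≡ just (char c)
  nth-letters (y ∷ ys) {t = zero}  _           = y , refl
  nth-letters (y ∷ ys) {t = suc _} (s≤s t<ys)  = nth-letters ys t<ys

  nth-end : ∀ (ys : List (Fin σ)) {z : Sym σ m} → nth s (map char ys ++ z ∷ []) (length ys) ≡ just z
  nth-end []       = refl
  nth-end (y ∷ ys) = nth-end ys

  nth-sentinel : ∀ (ys : List (Fin σ)) {j j' : Fin m} {t} →
                 nth s (map char ys ++ sent j ∷ []) t ≡ just (sent j') → t ≡ length ys × j ≡ j'
  nth-sentinel []       {t = zero}  refl = refl , refl
  nth-sentinel []       {t = suc _} ()
  nth-sentinel (y ∷ ys) {t = zero}  ()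
  nth-sentinel (y ∷ ys) {t = suc _} nth≡ with nth-sentinel ys nth≡
  ... | t≡ , j≡j' = cong suc t≡ , j≡j'

  body : Suffix k m → List (Fin σ)
  body (l , j) = drop (k ∸ toℕ l) (toList (s j))

  length-body : ∀ α → length (body α) ≡ len α
  length-body (l , j) = begin
    length (drop (k ∸ toℕ l) (toList (s j)))  ≡⟨ length-drop (k ∸ toℕ l) (toList (s j)) ⟩
    length (toList (s j)) ∸ (k ∸ toℕ l)        ≡⟨ cong (_∸ (k ∸ toℕ l)) (length-toList (s j)) ⟩
    k ∸ (k ∸ toℕ l)                            ≡⟨ m∸[m∸n]≡n (≤-pred (toℕ<n l)) ⟩
    toℕ l                                      ∎
    where open ≡-Reasoning

  nth-ext-sentinel : ∀ l j → nth s (ext s (l , j)) (toℕ l) ≡ just (sent j)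
  nth-ext-sentinel l j =
    subst (λ t → nth s (ext s (l , j)) t ≡ just (sent j)) (length-body (l , j)) (nth-end (body (l , j)))

  nth-ext-cong : ∀ {t p} α β → t < p → pre s p α ≡ pre s p β → nth s (ext s α) t ≡ nth s (ext s β) t
  nth-ext-cong {t} α β t<p pre≡ =
    trans (sym (nth-take (ext s α) t<p)) (trans (cong (λ xs → nth s xs t) pre≡) (nth-take (ext s β) t<p))

  -- The sentinel of α lies within the p-prefix, and it records both len α and idx α.
  pre-determines-short-suffix : ∀ {p l j} β → toℕ l < p → pre s p (l , j) ≡ pre s p β → (l , j) ≡ β
  pre-determines-short-suffix {l = l} {j} (l' , j') l<p pre≡
    with nth-sentinel (body (l' , j')) (trans (sym (nth-ext-cong (l , j) (l' , j') l<p pre≡)) (nth-ext-sentinel l j))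
  ... | l≡l' , refl = cong (_, j) (toℕ-injective (trans l≡l' (length-body (l' , j))))

  common-prefix⇒letter : ∀ q α β → pre s (suc q) α ≡ pre s (suc q) β → α ≢ β →
                         ∃[ c ] (nth s (ext s α) q ≡ just (char c) × nth s (ext s β) q ≡ just (char c))
  common-prefix⇒letter q (l , j) β pre≡ α≢β with toℕ l ≤? q
  ... | yes l≤q = ⊥-elim (α≢β (pre-determines-short-suffix β (s≤s l≤q) pre≡))
  ... | no l≰q with nth-letters (body (l , j)) (subst (q <_) (sym (length-body (l , j))) (≰⇒> l≰q))
  ...   | c , letterα = c , letterα , trans (sym (nth-ext-cong (l , j) β ≤-refl pre≡)) letterα

  letter⇒pthSym : ∀ q α {c} → nth s (ext s α) q ≡ just (char c) → pthSym s (suc q) α ≡ just c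
  letter⇒pthSym q _ nth≡ rewrite nth≡ = refl

  pthSym⇒letter : ∀ q α {c} → pthSym s (suc q) α ≡ just c → nth s (ext s α) q ≡ just (char c)
  pthSym⇒letter q α pth≡ with nth s (ext s α) q
  pthSym⇒letter q _ refl | just (char _) = refl
  pthSym⇒letter q _ ()   | just (sent _)
  pthSym⇒letter q _ ()   | nothing

  pre-restrict : ∀ {q p} α → q ≤ p → take q (pre s p α) ≡ pre s q α
  pre-restrict {q} {p} α q≤p =
    trans (take-take q p (ext s α)) (cong (λ n → take n (ext s α)) (m≤n⇒m⊓n≡m q≤p))

  pre≡-restrict : ∀ {q p} α β → q ≤ p → pre s p α ≡ pre s p β → pre s q α ≡ pre s q β
  pre≡-restrict {q} α β q≤p pre≡ =
    trans (sym (pre-restrict α q≤p)) (trans (cong (take q) pre≡) (pre-restrict β q≤p))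

  Prec⇒pre≼ : ∀ {q p α β} → q ≤ p → Prec s p α β → pre s q α ≼ᴸ pre s q β
  Prec⇒pre≼ {q} {α = α} {β} q≤p (inj₁ pre<) =
    subst₂ _≼ᴸ_ (pre-restrict α q≤p) (pre-restrict β q≤p) (take-mono-Lex-< q pre<)
  Prec⇒pre≼ {α = α} {β} q≤p (inj₂ (inj₁ (pre≡ , _))) = inj₂ (pre≡-restrict α β q≤p pre≡)
  Prec⇒pre≼ {α = α} {β} q≤p (inj₂ (inj₂ (pre≡ , _))) = inj₂ (pre≡-restrict α β q≤p pre≡)

  Prec-irrefl : ∀ {p} → Irreflexive _≡_ (Prec s p)
  Prec-irrefl refl (inj₁ pre<)                 = IsStrictTotalOrder.irrefl <ᴸ-isStrictTotalOrder refl pre<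
  Prec-irrefl refl (inj₂ (inj₁ (_ , l<l)))     = <-irrefl refl l<l
  Prec-irrefl refl (inj₂ (inj₂ (_ , _ , j<j))) = <-irrefl refl j<j

module Segments {σ k m : ℕ} (s : Fin m → Vec (Fin σ) k) (r : ℕ) (X : ℕ → Suffix k m)
                (increasing : Positions.IncreasingOn (N s) (Prec s r) X) where

  open SortedArrays (<ᴸ-isStrictTotalOrder {σ} {m}) (N s)

  key : ℕ → List (Sym σ m)
  key i = pre s r (X i)

  key-sorted : Sorted key
  key-sorted = increasing⇒sorted (pre s r) (λ {α} {β} → Prec⇒pre≼ s {α = α} {β} ≤-refl) increasing

  Continues : ℕ → Set
  Continues i = 1 ≤ i × key i ≡ key (suc i)

  continues? : U.Decidable Continues
  continues? i = (1 ≤? i) ×-dec (key i ≟ᴸ key (suc i))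

  segmentOf : ∀ {i} → 1 ≤ i → i ≤ N s → ∃[ b ] ∃[ e ] (IsSegment s r X b e × b ≤ i × i ≤ e)
  segmentOf {i} 1≤i i≤N
    with least (λ j → (1 ≤? j) ×-dec (key j ≟ᴸ key i)) (1≤i , refl)
       | greatest (λ j → key j ≟ᴸ key i) i≤N refl
  ... | b , b≤i , (1≤b , kb≡ki) , below | e , i≤e , e≤N , ke≡ki , above =
        b , e , (1≤b , b≤e , e≤N , same , maximal) , b≤i , i≤e
    where
      b≤e : b ≤ e
      b≤e = ≤-trans b≤i i≤e

      key≡ : ∀ {j} → b ≤ j → j ≤ e → key j ≡ key i
      key≡ b≤j j≤e = trans (sorted-convex key key-sorted 1≤b b≤j j≤e e≤N (trans kb≡ki (sym ke≡ki))) kb≡ki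

      same : SamePrefixOn s r X b e
      same j j' b≤j j≤e b≤j' j'≤e = trans (key≡ b≤j j≤e) (sym (key≡ b≤j' j'≤e))

      maximal : ∀ b' e' → 1 ≤ b' → b' ≤ b → e ≤ e' → e' ≤ N s → SamePrefixOn s r X b' e' →
                b' ≡ b × e' ≡ e
      maximal b' e' 1≤b' b'≤b e≤e' e'≤N same' =
          ≤-antisym b'≤b (≮⇒≥ λ b'<b → below b'<b (1≤b' , trans (same' b' b ≤-refl b'≤e' b'≤b b≤e') kb≡ki))
        , ≤-antisym (≮⇒≥ λ e<e' → above e<e' e'≤N (trans (same' e' e b'≤e' ≤-refl b'≤e e≤e') ke≡ki))
                    e≤e'
        where
          b≤e' = ≤-trans b≤e e≤e'
          b'≤e = ≤-trans b'≤b b≤e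
          b'≤e' = ≤-trans b'≤b b≤e'

  inner⇒continues : ∀ {b e i'} → IsSegment s r X b e → b < suc i' → suc i' ≤ e → Continues i'
  inner⇒continues {i' = i'} (1≤b , _ , _ , same , _) b<i i≤e =
    ≤-trans 1≤b (≤-pred b<i) , same i' (suc i') (≤-pred b<i) (≤-trans (n≤1+n i') i≤e) (<⇒≤ b<i) i≤e

  continues⇒¬start : ∀ {i'} → Continues i' → ¬ IsSegmentStart s r X (suc i')
  continues⇒¬start {i'} (1≤i' , ki'≡ki) (e , _ , i≤e , e≤N , same , maximal) =
    <⇒≢ (n<1+n i') (proj₁ (maximal i' e 1≤i' (n≤1+n i') ≤-refl e≤N same'))
    where
      key≡ : ∀ {j} → i' ≤ j → j ≤ e → key j ≡ key (suc i')
      key≡ i'≤j j≤e with m≤n⇒m<n∨m≡n i'≤j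
      ... | inj₁ i'<j = same _ (suc i') i'<j j≤e ≤-refl i≤e
      ... | inj₂ refl = ki'≡ki

      same' : SamePrefixOn s r X i' e
      same' j j' i'≤j j≤e i'≤j' j'≤e = trans (key≡ i'≤j j≤e) (sym (key≡ i'≤j' j'≤e))

  ¬continues⇒start : ∀ {i'} → suc i' ≤ N s → ¬ Continues i' → IsSegmentStart s r X (suc i')
  ¬continues⇒start i≤N ¬continues with segmentOf (s≤s z≤n) i≤N
  ... | b , e , segment , b≤i , i≤e with m≤n⇒m<n∨m≡n b≤i
  ...   | inj₁ b<i  = ⊥-elim (¬continues (inner⇒continues segment b<i i≤e))
  ...   | inj₂ refl = e , segment

  continues⇒inner : ∀ {i'} → suc i' ≤ N s → Continues i' →
                    ∃[ b ] ∃[ e ] (IsSegment s r X b e × b ≤ suc i' × suc i' ≤ e × b < suc i')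
  continues⇒inner i≤N continues with segmentOf (s≤s z≤n) i≤N
  ... | b , e , segment , b≤i , i≤e =
        b , e , segment , b≤i , i≤e , ≤∧≢⇒< b≤i λ { refl → continues⇒¬start continues (e , segment) }

module Interleaves {σ k m : ℕ} (s : Fin m → Vec (Fin σ) k) (X : ℕ → ℕ → Suffix k m)
                   (interleave : ∀ p → IsInterleave s p (X p)) where

  open Positions (N s)
  open SortedArrays (<ᴸ-isStrictTotalOrder {σ} {m}) (N s)
  module Seg p = Segments s p (X p) (proj₁ (interleave p))
  open Seg using (Continues)

  enumerates : ∀ p → IsEnumeration (X p)
  enumerates p = increasing⇒injective (Prec-irrefl s) (proj₁ (interleave p)) , proj₂ (interleave p)

  prefix-stable : ∀ q {i} → 1 ≤ i → i ≤ N s → pre s q (X q i) ≡ pre s q (X (suc q) i)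
  prefix-stable q = sorted-keys-agree (pre s q) (Seg.key-sorted q) sorted-next (enumerates q) (enumerates (suc q))
    where
      sorted-next : Sorted (pre s q ∘ X (suc q))
      sorted-next = increasing⇒sorted (pre s q) (λ {α} {β} → Prec⇒pre≼ s {α = α} {β} (n≤1+n q))
                                      (proj₁ (interleave (suc q)))

  updateCond⇒continues : ∀ q {i'} → suc i' ≤ N s → UpdateCond s X q (suc i') → Continues (suc q) i'
  updateCond⇒continues q {i'} i≤N ((c , c-at-i , c-at-i') , b , e , segment , _ , i≤e , b<i) = 1≤i' , (begin
    pre s (suc q) α              ≡⟨ take-suc-nth s q (ext s α) (pthSym⇒letter s q α c-at-i') ⟩
    pre s q α ++ char c ∷ []     ≡⟨ cong (_++ char c ∷ []) q-prefixes ⟩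
    pre s q β ++ char c ∷ []     ≡⟨ take-suc-nth s q (ext s β) (pthSym⇒letter s q β c-at-i) ⟨
    pre s (suc q) β              ∎)
    where
      open ≡-Reasoning
      α = X (suc q) i'
      β = X (suc q) (suc i')
      continues = Seg.inner⇒continues q segment b<i i≤e
      1≤i' = proj₁ continues

      q-prefixes : pre s q α ≡ pre s q β
      q-prefixes = trans (sym (prefix-stable q 1≤i' (≤-trans (n≤1+n i') i≤N)))
                         (trans (proj₂ continues) (prefix-stable q (s≤s z≤n) i≤N))

  continues⇒updateCond : ∀ q {i'} → suc i' ≤ N s → Continues (suc q) i' → UpdateCond s X q (suc i')
  continues⇒updateCond q {i'} i≤N (1≤i' , same) =
      (c , letter⇒pthSym s q β c-at-i , letter⇒pthSym s q α c-at-i')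
    , Seg.continues⇒inner q i≤N (1≤i' , q-prefixes)
    where
      α = X (suc q) i'
      β = X (suc q) (suc i')
      i'≤N = ≤-trans (n≤1+n i') i≤N

      α≢β : α ≢ β
      α≢β α≡β = <⇒≢ (n<1+n i') (proj₁ (enumerates (suc q)) 1≤i' i'≤N (s≤s z≤n) i≤N α≡β)

      letters = common-prefix⇒letter s q α β same α≢β
      c = proj₁ letters
      c-at-i' = proj₁ (proj₂ letters)
      c-at-i = proj₂ (proj₂ letters)

      q-prefixes : pre s q (X q i') ≡ pre s q (X q (suc i'))
      q-prefixes = trans (prefix-stable q 1≤i' i'≤N)
                         (trans (pre≡-restrict s α β (n≤1+n q) same) (sym (prefix-stable q (s≤s z≤n) i≤N)))

  module _ {L : ℕ → ℕ → ℕ} (lcp : IsLcp s X L) where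

    Lcp-update : ∀ q {i'} → suc i' ≤ N s → Continues (suc q) i' → L (suc q) (suc i') ≡ suc q
    Lcp-update q {i'} i≤N = proj₁ (proj₂ lcp q (suc i') (s≤s z≤n) i≤N) ∘ continues⇒updateCond q i≤N

    Lcp-keep : ∀ q {i'} → suc i' ≤ N s → ¬ Continues (suc q) i' → L (suc q) (suc i') ≡ L q (suc i')
    Lcp-keep q {i'} i≤N ¬continues =
      proj₂ (proj₂ lcp q (suc i') (s≤s z≤n) i≤N) (¬continues ∘ updateCond⇒continues q i≤N)

    Lcp-bounded : ∀ q {i} → 1 ≤ i → i ≤ N s → L q i ≤ q
    Lcp-bounded zero    1≤i i≤N = ≤-reflexive (proj₁ lcp _ 1≤i i≤N)
    Lcp-bounded (suc q) {suc i'} 1≤i i≤N with Seg.continues? (suc q) i'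
    ... | yes continues  = ≤-reflexive (Lcp-update q i≤N continues)
    ... | no ¬continues  =
      ≤-trans (≤-reflexive (Lcp-keep q i≤N ¬continues)) (m≤n⇒m≤1+n (Lcp-bounded q 1≤i i≤N))

    Lcp≡suc⇔continues : ∀ q {i'} → suc i' ≤ N s → L (suc q) (suc i') ≡ suc q ⇔ Continues (suc q) i'
    Lcp≡suc⇔continues q {i'} i≤N = mk⇔ to (Lcp-update q i≤N)
      where
        to : L (suc q) (suc i') ≡ suc q → Continues (suc q) i'
        to L≡ with Seg.continues? (suc q) i'
        ... | yes continues = continues
        ... | no ¬continues = ⊥-elim (1+n≰n (begin
          suc q              ≡⟨ L≡ ⟨
          L (suc q) (suc i') ≡⟨ Lcp-keep q i≤N ¬continues ⟩
          L q (suc i')       ≤⟨ Lcp-bounded q (s≤s z≤n) i≤N ⟩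
          q                  ∎))
          where open ≤-Reasoning

mainTheorem4 : (σ k m : ℕ) (s : Fin m → Vec (Fin σ) k)
    → (X : ℕ → ℕ → Suffix k m) → (∀ p → IsInterleave s p (X p))
    → (L : ℕ → ℕ → ℕ) → IsLcp s X L
    → ∀ p → 1 ≤ p → ∀ i → 1 ≤ i → i ≤ N s
    → (L p i ≡ p → ¬ IsSegmentStart s p (X p) i)
    × (¬ IsSegmentStart s p (X p) i → L p i ≡ p)
mainTheorem4 σ k m s X interleave L lcp (suc q) _ (suc i') _ i≤N =
    (continues⇒¬start ∘ to)
  , (λ ¬start → from (decidable-stable (continues? i') (¬start ∘ ¬continues⇒start i≤N)))
  where
    open Interleaves s X interleave using (module Seg; Lcp≡suc⇔continues)
    open Seg (suc q) using (continues?; continues⇒¬start; ¬continues⇒start)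
    open Equivalence (Lcp≡suc⇔continues lcp q i≤N) using (to; from)
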